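{- Let $k\ge 2$ and $n\ge 1$. For $j\in\{1,\dots,k\}$ and $x\in\{1,\dots,k^{n-1}\}$, the smallest chip that can land at the landing order $(j,x)$ on layer 2 is $a(j,x)=jx$, and the largest is $b(j,x)=k^n+1-(k^{n-1}+1-x)(k+1-j)$.
   Context: The infinite rooted directed $k$-ary tree: every vertex has $k$ children ordered from leftmost (1st) to rightmost ($k$th); the root is on layer 1 and its children on layer 2. Labeled chip-firing: initially chips labeled $1,\dots,k^n$ are on the root; a vertex holding at least $k$ chips may fire by choosing any $k$ of its chips and sending the chip with the $r$-th smallest label to its $r$-th leftmost child ($r=1,\dots,k$); a firing strategy is any sequence of such choices. Exactly $k^{n-1}$ chips arrive at each child of the root. A chip $c$ can land at the landing order $(j,x)$ if under some strategy $c$ is the $x$-th smallest of the chips that arrive at the $j$-th leftmost child of the root. -}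

module Defs where

open import Data.Nat using (ℕ; zero; suc; _+_; _*_; _∸_; _^_; _≤_; _<_)
open import Data.Nat.Properties using (_<?_)
open import Data.Fin as Fin using (Fin; toℕ)
open import Data.List using (List; map; upTo; concatMap; filter; length)
open import Data.List.Relation.Unary.All using (All)
open import Data.List.Membership.Propositional using (_∈_)
open import Data.List.Relation.Binary.Permutation.Propositional using (_↭_)
open import Data.Vec.Functional using (toList)
open import Data.Product using (Σ; _×_)
open import Relation.Binary.PropositionalEquality using (_≡_)

-- A single firing of the root of the k-ary tree: k chosen chips listed in
-- increasing order; entry r (0-based) is the (r+1)-th smallest chip, sent to
-- the (r+1)-th leftmost child.
Firing : ℕ → Set
Firing k = Fin k → ℕ

IncreasingFiring : (k : ℕ) → Firing k → Set
IncreasingFiring k f = ∀ (r s : Fin k) → r Fin.< s → f r < f s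

chips : ℕ → ℕ → List ℕ
chips k n = map suc (upTo (k ^ n))

-- A complete root firing strategy: the sequence of root firings, each choosing
-- k chips among those still on the root, until the root is emptied.
-- (Firings at other vertices never affect which chips arrive at layer 2.)
-- Each chip is chosen exactly once overall: the concatenation of the chosen
-- chips is a permutation of the initial chips.
record RootStrategy (k n : ℕ) : Set where
  field
    firings    : List (Firing k)
    increasing : All (IncreasingFiring k) firings
    usesAll    : concatMap toList firings ↭ chips k n

arrivals : {k n : ℕ} → RootStrategy k n → Fin k → List ℕ
arrivals S j = map (λ f → f j) (RootStrategy.firings S)

-- Chip c can land at landing order (toℕ j + 1, x): under some strategy, c arrives
-- at child j and is the x-th smallest of the chips arriving there.
CanLand : (k n : ℕ) → Fin k → ℕ → ℕ → Set
CanLand k n j x c =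
  Σ (RootStrategy k n) λ S →
    (c ∈ arrivals S j) × (suc (length (filter (_<? c) (arrivals S j))) ≡ x)

IsLeast : (ℕ → Set) → ℕ → Set
IsLeast P m = P m × (∀ c → P c → m ≤ c)

IsGreatest : (ℕ → Set) → ℕ → Set
IsGreatest P m = P m × (∀ c → P c → c ≤ m)

{-# OPTIONS --safe #-}
module Submission where

open import Defs
open import Data.Nat using (ℕ; zero; suc; _+_; _*_; _∸_; _^_; _≤_; _<_; z≤n; s≤s; _≤?_; _<?_)
open import Data.Nat.Properties
open import Data.Nat.Tactic.RingSolver using (solve-∀)
open import Data.Fin as Fin using (Fin; toℕ)
open import Data.Fin.Properties using (toℕ<n; toℕ-injective; nonZeroIndex)
open import Data.List using (List; []; _∷_; _++_; [_]; map; concatMap; length; filter; upTo; applyUpTo; tabulate)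
open import Data.List.Properties
  using (map-++; map-∘; length-map; length-++; length-upTo; length-tabulate; map-upTo; ++-assoc;
         concatMap-++; concatMap-map; concatMap-cong; length-filter; filter-++; filter-all; filter-none; filter-some;
         filter-accept; filter-reject)
open import Data.List.Relation.Unary.All as All using (All; []; _∷_)
import Data.List.Relation.Unary.All.Properties as All
open import Data.List.Relation.Unary.Any using (here; there)
open import Data.List.Membership.Propositional using (_∈_; lose)
open import Data.List.Membership.Propositional.Properties using (∈-map⁺; ∈-++⁺ˡ)
open import Data.List.Relation.Binary.Permutation.Propositional using (_↭_; ↭-refl; module PermutationReasoning)
open import Data.List.Relation.Binary.Permutation.Propositional.Properties
  using (++⁺ˡ; ++⁺ʳ; shifts; filter-↭; ↭-length) renaming (++-comm to ↭-++-comm)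
open import Data.List.Relation.Binary.Sublist.Propositional using (⊆-refl)
open import Data.List.Relation.Binary.Sublist.Propositional.Properties using (filter⁺; length-mono-≤)
open import Data.Vec.Functional using (toList)
open import Data.Product using (_×_; _,_)
open import Data.Sum using (inj₁; inj₂)
open import Function using (_∘_)
open import Relation.Binary.PropositionalEquality
  using (_≡_; refl; sym; trans; cong; cong₂; subst; module ≡-Reasoning)
open import Relation.Nullary using (yes; no; ¬_; contradiction)
open import Relation.Unary using (Decidable)

-- Every complete strategy fires the root N = k^(n-1) times, and each firing sends one chip to
-- child j together with j-1 smaller chips to the children on its left and k-j larger ones to the
-- children on its right. If c is the x-th smallest arrival at child j, then x firings send child j
-- a chip ≤ c, so at least jx of the chips 1,…,k^n are ≤ c and c ≥ jx. Dually N+1-x firings send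
-- it a chip ≥ c, so (k+1-j)(N+1-x) ≤ k^n+1-c. Both bounds are attained by cutting 1,…,k^n into a
-- low, a middle and a high band of consecutive chips: each of p "split" firings takes s
-- consecutive low chips and k-s consecutive high chips, each remaining firing takes k consecutive
-- middle chips. With s = j and p = x the x-th arrival at child j is jx; with s = j-1 and
-- p = N+1-x it is the first high chip, k^n+1-(k+1-j)(N+1-x).

module _ {A : Set} {P : A → Set} (P? : Decidable P) where

  count : List A → ℕ
  count xs = length (filter P? xs)

  count-++ : ∀ xs ys → count (xs ++ ys) ≡ count xs + count ys
  count-++ xs ys = trans (cong length (filter-++ P? xs ys)) (length-++ (filter P? xs))

  count-↭ : ∀ {xs ys} → xs ↭ ys → count xs ≡ count ys
  count-↭ xs↭ys = ↭-length (filter-↭ P? xs↭ys)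

  count-all : ∀ {xs} → All P xs → count xs ≡ length xs
  count-all all = cong length (filter-all P? all)

  count-none : ∀ {xs} → All (¬_ ∘ P) xs → count xs ≡ 0
  count-none none = cong length (filter-none P? none)

  count-∈ : ∀ {x xs} → x ∈ xs → P x → 0 < count xs
  count-∈ x∈xs px = filter-some P? (lose x∈xs px)

  -- `with P? x` does not reduce `count (x ∷ xs)` when P? unfolds to a boolean test such as
  -- `_<ᵇ_`, so concrete counts are rewritten with these two instead.
  count-accept : ∀ {x xs} → P x → count (x ∷ xs) ≡ suc (count xs)
  count-accept px = cong length (filter-accept P? px)

  count-reject : ∀ {x xs} → ¬ P x → count (x ∷ xs) ≡ count xs
  count-reject ¬px = cong length (filter-reject P? ¬px)

module _ {A B : Set} {P : B → Set} (P? : Decidable P) (h : A → B) (g : A → List B) {m : ℕ} where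

  *-count-map≤count-concatMap : ∀ {xs} → All (λ a → P (h a) → m ≤ count P? (g a)) xs →
                                m * count P? (map h xs) ≤ count P? (concatMap g xs)
  *-count-map≤count-concatMap {[]} [] = ≤-reflexive (*-zeroʳ m)
  *-count-map≤count-concatMap {a ∷ xs} (bound ∷ bounds) with P? (h a)
  ... | yes pa = begin
    m * suc (count P? (map h xs))              ≡⟨ *-suc m _ ⟩
    m + m * count P? (map h xs)                ≤⟨ +-mono-≤ (bound pa) (*-count-map≤count-concatMap bounds) ⟩
    count P? (g a) + count P? (concatMap g xs) ≡⟨ count-++ P? (g a) _ ⟨
    count P? (g a ++ concatMap g xs)           ∎
    where open ≤-Reasoning
  ... | no _ = begin
    m * count P? (map h xs)                    ≤⟨ *-count-map≤count-concatMap bounds ⟩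
    count P? (concatMap g xs)                  ≤⟨ m≤n+m _ _ ⟩
    count P? (g a) + count P? (concatMap g xs) ≡⟨ count-++ P? (g a) _ ⟨
    count P? (g a ++ concatMap g xs)           ∎
    where open ≤-Reasoning

count-<+count-≥ : ∀ c xs → count (_<? c) xs + count (c ≤?_) xs ≡ length xs
count-<+count-≥ c [] = refl
count-<+count-≥ c (x ∷ xs) with x <? c
... | yes x<c = begin
  count (_<? c) (x ∷ xs) + count (c ≤?_) (x ∷ xs)
    ≡⟨ cong₂ _+_ (count-accept (_<? c) x<c) (count-reject (c ≤?_) (<⇒≱ x<c)) ⟩
  suc (count (_<? c) xs + count (c ≤?_) xs)
    ≡⟨ cong suc (count-<+count-≥ c xs) ⟩
  suc (length xs) ∎
  where open ≡-Reasoning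
... | no x≮c = begin
  count (_<? c) (x ∷ xs) + count (c ≤?_) (x ∷ xs)
    ≡⟨ cong₂ _+_ (count-reject (_<? c) x≮c) (count-accept (c ≤?_) (≮⇒≥ x≮c)) ⟩
  count (_<? c) xs + suc (count (c ≤?_) xs)
    ≡⟨ +-suc _ _ ⟩
  suc (count (_<? c) xs + count (c ≤?_) xs)
    ≡⟨ cong suc (count-<+count-≥ c xs) ⟩
  suc (length xs) ∎
  where open ≡-Reasoning

count-<≤count-≤ : ∀ c xs → count (_<? c) xs ≤ count (_≤? c) xs
count-<≤count-≤ c xs = length-mono-≤ (filter⁺ (_<? c) (_≤? c) (λ { refl → <⇒≤ }) (⊆-refl {x = xs}))

suc[count-<]≤count-≤ : ∀ {c xs} → c ∈ xs → suc (count (_<? c) xs) ≤ count (_≤? c) xs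
suc[count-<]≤count-≤ {c} {x ∷ xs} (here refl) = begin
  suc (count (_<? c) (c ∷ xs)) ≡⟨ cong suc (count-reject (_<? c) (n≮n c)) ⟩
  suc (count (_<? c) xs)       ≤⟨ s≤s (count-<≤count-≤ c xs) ⟩
  suc (count (_≤? c) xs)       ≡⟨ count-accept (_≤? c) ≤-refl ⟨
  count (_≤? c) (c ∷ xs)       ∎
  where open ≤-Reasoning
suc[count-<]≤count-≤ {c} {x ∷ xs} (there c∈xs) with x <? c | x ≤? c
... | yes x<c | yes x≤c
  rewrite count-accept (_<? c) {xs = xs} x<c | count-accept (_≤? c) {xs = xs} x≤c
  = s≤s (suc[count-<]≤count-≤ c∈xs)
... | yes x<c | no x≰c = contradiction (<⇒≤ x<c) x≰c
... | no x≮c  | yes x≤c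
  rewrite count-reject (_<? c) {xs = xs} x≮c | count-accept (_≤? c) {xs = xs} x≤c
  = m≤n⇒m≤1+n (suc[count-<]≤count-≤ c∈xs)
... | no x≮c  | no x≰c
  rewrite count-reject (_<? c) {xs = xs} x≮c | count-reject (_≤? c) {xs = xs} x≰c
  = suc[count-<]≤count-≤ c∈xs

range : ℕ → ℕ → List ℕ
range a zero    = []
range a (suc m) = a ∷ range (suc a) m

length-range : ∀ a m → length (range a m) ≡ m
length-range a zero    = refl
length-range a (suc m) = cong suc (length-range (suc a) m)

range-++ : ∀ a m n → range a (m + n) ≡ range a m ++ range (a + m) n
range-++ a zero    n = cong (λ b → range b n) (sym (+-identityʳ a))
range-++ a (suc m) n = cong (a ∷_) (trans (range-++ (suc a) m n)
  (cong (λ b → range (suc a) m ++ range b n) (sym (+-suc a m))))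

range-suc : ∀ a m → range a (suc m) ≡ range a m ++ [ a + m ]
range-suc a m = trans (cong (range a) (+-comm 1 m)) (range-++ a m 1)

∈-range⁺ : ∀ {a m i} → a ≤ i → i < a + m → i ∈ range a m
∈-range⁺ {a} {zero}  a≤i i<a+0 = contradiction (subst (_ <_) (+-identityʳ a) i<a+0) (≤⇒≯ a≤i)
∈-range⁺ {a} {suc m} {i} a≤i i<a+m with m≤n⇒m<n∨m≡n a≤i
... | inj₂ refl = here refl
... | inj₁ a<i  = there (∈-range⁺ a<i (subst (i <_) (+-suc a m) i<a+m))

All-range : ∀ {P : ℕ → Set} a m → (∀ {i} → a ≤ i → i < a + m → P i) → All P (range a m)
All-range a zero    _ = []
All-range a (suc m) p = p ≤-refl (m<m+n a (s≤s z≤n))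
  ∷ All-range (suc a) m (λ {i} a<i i<a+m → p (<⇒≤ a<i) (subst (i <_) (sym (+-suc a m)) i<a+m))

map-range : ∀ (g : ℕ → ℕ) a b m → (∀ {i} → i < m → g (a + i) ≡ b + i) → map g (range a m) ≡ range b m
map-range g a b zero    _ = refl
map-range g a b (suc m) e = cong₂ _∷_
  (trans (cong g (sym (+-identityʳ a))) (trans (e (s≤s z≤n)) (+-identityʳ b)))
  (map-range g (suc a) (suc b) m
    (λ i<m → trans (cong g (sym (+-suc a _))) (trans (e (s≤s i<m)) (+-suc b _))))

tabulate-toℕ : ∀ {A : Set} {k} (g : ℕ → A) → tabulate {n = k} (g ∘ toℕ) ≡ map g (range 0 k)
tabulate-toℕ {k = zero}  g = refl
tabulate-toℕ {k = suc k} g = cong (g 0 ∷_) (begin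
  tabulate {n = k} ((g ∘ suc) ∘ toℕ) ≡⟨ tabulate-toℕ (g ∘ suc) ⟩
  map (g ∘ suc) (range 0 k)          ≡⟨ map-∘ (range 0 k) ⟩
  map g (map suc (range 0 k))        ≡⟨ cong (map g) (map-range suc 0 1 k (λ _ → refl)) ⟩
  map g (range 1 k)                  ∎)
  where open ≡-Reasoning

upTo≡range : ∀ m → upTo m ≡ range 0 m
upTo≡range zero    = refl
upTo≡range (suc m) = cong (0 ∷_) (begin
  applyUpTo suc m        ≡⟨ map-upTo suc m ⟨
  map suc (upTo m)       ≡⟨ cong (map suc) (upTo≡range m) ⟩
  map suc (range 0 m)    ≡⟨ map-range suc 0 1 m (λ _ → refl) ⟩
  range 1 m              ∎)
  where open ≡-Reasoning

chips≡range : ∀ k n → chips k n ≡ range 1 (k ^ n)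
chips≡range k n = trans (cong (map suc) (upTo≡range (k ^ n))) (map-range suc 0 1 (k ^ n) (λ _ → refl))

concatMap-range-blocks : ∀ a m b p →
  concatMap (λ i → range (i * m + a) m) (range b p) ≡ range (b * m + a) (p * m)
concatMap-range-blocks a m b zero    = refl
concatMap-range-blocks a m b (suc p) = begin
  range (b * m + a) m ++ concatMap (λ i → range (i * m + a) m) (range (suc b) p)
    ≡⟨ cong (range (b * m + a) m ++_) (concatMap-range-blocks a m (suc b) p) ⟩
  range (b * m + a) m ++ range (suc b * m + a) (p * m)
    ≡⟨ cong (λ c → range (b * m + a) m ++ range c (p * m)) (next-block b m a) ⟩
  range (b * m + a) m ++ range (b * m + a + m) (p * m)
    ≡⟨ range-++ (b * m + a) m (p * m) ⟨
  range (b * m + a) (m + p * m) ∎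
  where
  open ≡-Reasoning
  next-block : ∀ b m a → suc b * m + a ≡ b * m + a + m
  next-block = solve-∀

concatMap-++-↭ : ∀ {A B : Set} (f g : A → List B) xs →
                 concatMap (λ a → f a ++ g a) xs ↭ concatMap f xs ++ concatMap g xs
concatMap-++-↭ f g []       = ↭-refl
concatMap-++-↭ f g (a ∷ xs) = begin
  (f a ++ g a) ++ concatMap (λ a → f a ++ g a) xs  ≡⟨ ++-assoc (f a) (g a) _ ⟩
  f a ++ g a ++ concatMap (λ a → f a ++ g a) xs    ↭⟨ ++⁺ˡ (f a) (++⁺ˡ (g a) (concatMap-++-↭ f g xs)) ⟩
  f a ++ g a ++ concatMap f xs ++ concatMap g xs   ↭⟨ ++⁺ˡ (f a) (shifts (g a) (concatMap f xs)) ⟩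
  f a ++ concatMap f xs ++ g a ++ concatMap g xs   ≡⟨ ++-assoc (f a) (concatMap f xs) _ ⟨
  (f a ++ concatMap f xs) ++ g a ++ concatMap g xs ∎
  where open PermutationReasoning

module _ {P : ℕ → Set} (P? : Decidable P) (g : ℕ → ℕ) where

  count-map-range-all : ∀ m → (∀ {i} → i < m → P (g i)) → count P? (map g (range 0 m)) ≡ m
  count-map-range-all m p = begin
    count P? (map g (range 0 m)) ≡⟨ count-all P? (All.map⁺ (All-range 0 m (λ _ → p))) ⟩
    length (map g (range 0 m))   ≡⟨ length-map g (range 0 m) ⟩
    length (range 0 m)           ≡⟨ length-range 0 m ⟩
    m                            ∎
    where open ≡-Reasoning

  count-map-range-none : ∀ m → (∀ {i} → i < m → ¬ P (g i)) → count P? (map g (range 0 m)) ≡ 0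
  count-map-range-none m ¬p = count-none P? (All.map⁺ (All-range 0 m (λ _ → ¬p)))

count-≤-range : ∀ c a m → count (_≤? c) (range a m) ≤ suc c ∸ a
count-≤-range c a zero = z≤n
count-≤-range c a (suc m) with a ≤? c
... | yes a≤c rewrite count-accept (_≤? c) {xs = range (suc a) m} a≤c
  = ≤-trans (s≤s (count-≤-range c (suc a) m)) (≤-reflexive (sym (+-∸-assoc 1 a≤c)))
... | no a≰c rewrite count-reject (_≤? c) {xs = range (suc a) m} a≰c
  = ≤-trans (count-≤-range c (suc a) m) (∸-monoˡ-≤ a (n≤1+n c))

count-≥-range : ∀ c a m → count (c ≤?_) (range a m) ≤ a + m ∸ c
count-≥-range c a zero = z≤n
count-≥-range c a (suc m) with c ≤? a
... | yes c≤a = begin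
  count (c ≤?_) (range a (suc m)) ≤⟨ length-filter (c ≤?_) (range a (suc m)) ⟩
  length (range a (suc m))       ≡⟨ length-range a (suc m) ⟩
  suc m                          ≤⟨ m≤n+m (suc m) (a ∸ c) ⟩
  a ∸ c + suc m                  ≡⟨ +-∸-comm (suc m) c≤a ⟨
  a + suc m ∸ c                  ∎
  where open ≤-Reasoning
... | no c≰a rewrite count-reject (c ≤?_) {xs = range (suc a) m} c≰a
  = subst (λ b → count (c ≤?_) (range (suc a) m) ≤ b ∸ c) (sym (+-suc a m)) (count-≥-range c (suc a) m)

increasing-mono : ∀ {k} {f : Firing k} → IncreasingFiring k f → ∀ {r s} → toℕ r ≤ toℕ s → f r ≤ f s
increasing-mono {f = f} inc r≤s with m≤n⇒m<n∨m≡n r≤s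
... | inj₁ r<s = <⇒≤ (inc _ _ r<s)
... | inj₂ r≡s = ≤-reflexive (cong f (toℕ-injective r≡s))

module _ {P : ℕ → Set} (P? : Decidable P) where

  suc-toℕ≤count-tabulate : ∀ {k} (f : Fin k → ℕ) (j : Fin k) → (∀ r → toℕ r ≤ toℕ j → P (f r)) →
                           suc (toℕ j) ≤ count P? (tabulate f)
  suc-toℕ≤count-tabulate f Fin.zero p with P? (f Fin.zero)
  ... | yes _  = s≤s z≤n
  ... | no ¬p = contradiction (p Fin.zero z≤n) ¬p
  suc-toℕ≤count-tabulate f (Fin.suc j) p with P? (f Fin.zero)
  ... | yes _  = s≤s (suc-toℕ≤count-tabulate (f ∘ Fin.suc) j (λ r r≤j → p (Fin.suc r) (s≤s r≤j)))
  ... | no ¬p = contradiction (p Fin.zero z≤n) ¬p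

  ∸-toℕ≤count-tabulate : ∀ {k} (f : Fin k → ℕ) (j : Fin k) → (∀ r → toℕ j ≤ toℕ r → P (f r)) →
                         k ∸ toℕ j ≤ count P? (tabulate f)
  ∸-toℕ≤count-tabulate f Fin.zero p =
    ≤-reflexive (sym (trans (count-all P? (All.tabulate⁺ (λ r → p r z≤n))) (length-tabulate f)))
  ∸-toℕ≤count-tabulate f (Fin.suc j) p with P? (f Fin.zero)
  ... | yes _ = m≤n⇒m≤1+n (∸-toℕ≤count-tabulate (f ∘ Fin.suc) j (λ r j≤r → p (Fin.suc r) (s≤s j≤r)))
  ... | no _  = ∸-toℕ≤count-tabulate (f ∘ Fin.suc) j (λ r j≤r → p (Fin.suc r) (s≤s j≤r))

length-concatMap-toList : ∀ {A : Set} {k} (fs : List (Fin k → A)) →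
                          length (concatMap toList fs) ≡ k * length fs
length-concatMap-toList {k = k} []       = sym (*-zeroʳ k)
length-concatMap-toList {k = k} (f ∷ fs) = begin
  length (toList f ++ concatMap toList fs)         ≡⟨ length-++ (toList f) ⟩
  length (toList f) + length (concatMap toList fs) ≡⟨ cong₂ _+_ (length-tabulate f) (length-concatMap-toList fs) ⟩
  k + k * length fs                                ≡⟨ *-suc k (length fs) ⟨
  k * suc (length fs)                              ∎
  where open ≡-Reasoning

module _ {k n : ℕ} (S : RootStrategy k n) where
  open RootStrategy S

  count-chips : ∀ {P : ℕ → Set} (P? : Decidable P) →
                count P? (concatMap toList firings) ≡ count P? (range 1 (k ^ n))
  count-chips P? = trans (count-↭ P? usesAll) (cong (count P?) (chips≡range k n))

  module _ (j : Fin k) where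

    suc-toℕ*count-arrivals-≤ : ∀ c → suc (toℕ j) * count (_≤? c) (arrivals S j) ≤ c
    suc-toℕ*count-arrivals-≤ c = begin
      suc (toℕ j) * count (_≤? c) (arrivals S j) ≤⟨ *-count-map≤count-concatMap (_≤? c) (λ f → f j) toList
                                                      (All.map below increasing) ⟩
      count (_≤? c) (concatMap toList firings)   ≡⟨ count-chips (_≤? c) ⟩
      count (_≤? c) (range 1 (k ^ n))            ≤⟨ count-≤-range c 1 (k ^ n) ⟩
      c                                          ∎
      where
      open ≤-Reasoning
      below : ∀ {f} → IncreasingFiring k f → f j ≤ c → suc (toℕ j) ≤ count (_≤? c) (toList f)
      below {f} inc fj≤c =
        suc-toℕ≤count-tabulate (_≤? c) f j (λ r r≤j → ≤-trans (increasing-mono inc r≤j) fj≤c)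

    ∸-toℕ*count-arrivals-≥ : ∀ c → (k ∸ toℕ j) * count (c ≤?_) (arrivals S j) ≤ suc (k ^ n) ∸ c
    ∸-toℕ*count-arrivals-≥ c = begin
      (k ∸ toℕ j) * count (c ≤?_) (arrivals S j) ≤⟨ *-count-map≤count-concatMap (c ≤?_) (λ f → f j) toList
                                                      (All.map above increasing) ⟩
      count (c ≤?_) (concatMap toList firings)   ≡⟨ count-chips (c ≤?_) ⟩
      count (c ≤?_) (range 1 (k ^ n))            ≤⟨ count-≥-range c 1 (k ^ n) ⟩
      suc (k ^ n) ∸ c                            ∎
      where
      open ≤-Reasoning
      above : ∀ {f} → IncreasingFiring k f → c ≤ f j → k ∸ toℕ j ≤ count (c ≤?_) (toList f)
      above {f} inc c≤fj =
        ∸-toℕ≤count-tabulate (c ≤?_) f j (λ r j≤r → ≤-trans c≤fj (increasing-mono inc j≤r))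

    k*length-arrivals : k * length (arrivals S j) ≡ k ^ n
    k*length-arrivals = begin
      k * length (arrivals S j)               ≡⟨ cong (k *_) (length-map (λ f → f j) firings) ⟩
      k * length firings                      ≡⟨ length-concatMap-toList firings ⟨
      length (concatMap toList firings)       ≡⟨ ↭-length usesAll ⟩
      length (chips k n)                      ≡⟨ length-map suc (upTo (k ^ n)) ⟩
      length (upTo (k ^ n))                   ≡⟨ length-upTo (k ^ n) ⟩
      k ^ n                                   ∎
      where open ≡-Reasoning

landing-lowerBound : ∀ {k n j x c} → CanLand k n j x c → suc (toℕ j) * x ≤ c
landing-lowerBound {j = j} (S , c∈arrivals , refl) =
  ≤-trans (*-monoʳ-≤ (suc (toℕ j)) (suc[count-<]≤count-≤ c∈arrivals)) (suc-toℕ*count-arrivals-≤ S j _)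

landing-upperBound : ∀ {k n j x c} → CanLand k (suc n) j x c →
                     c + (k ∸ toℕ j) * (suc (k ^ n) ∸ x) ≤ suc (k ^ suc n)
landing-upperBound {k} {n} {j} {c = c} (S , c∈arrivals , refl) =
  subst (λ m → c + (k ∸ toℕ j) * m ≤ suc (k ^ suc n)) count-≥≡
    (0<m≤o∸n⇒n+m≤o (*-mono-≤ 0<k∸j 0<count-≥) (∸-toℕ*count-arrivals-≥ S j c))
  where
  as : List ℕ
  as = arrivals S j
  length-as : length as ≡ k ^ n
  length-as = *-cancelˡ-≡ (length as) (k ^ n) k {{nonZeroIndex j}} (k*length-arrivals S j)
  count-≥≡ : count (c ≤?_) as ≡ k ^ n ∸ count (_<? c) as
  count-≥≡ = begin
    count (c ≤?_) as
      ≡⟨ m+n∸m≡n (count (_<? c) as) _ ⟨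
    count (_<? c) as + count (c ≤?_) as ∸ count (_<? c) as
      ≡⟨ cong (_∸ count (_<? c) as) (trans (count-<+count-≥ c as) length-as) ⟩
    k ^ n ∸ count (_<? c) as ∎
    where open ≡-Reasoning
  0<k∸j : 0 < k ∸ toℕ j
  0<k∸j = m<n⇒0<n∸m (toℕ<n j)
  0<count-≥ : 0 < count (c ≤?_) as
  0<count-≥ = count-∈ (c ≤?_) c∈arrivals ≤-refl
  0<m≤o∸n⇒n+m≤o : ∀ {m n o} → 0 < m → m ≤ o ∸ n → n + m ≤ o
  0<m≤o∸n⇒n+m≤o {m} {n} {o} 0<m m≤o∸n =
    subst (_≤ o) (+-comm m n) (m≤o∸n⇒m+n≤o m (<⇒≤ n<o) m≤o∸n)
    where
    n<o : n < o
    n<o = m∸n≢0⇒n<m (λ o∸n≡0 → <⇒≱ 0<m (subst (m ≤_) o∸n≡0 m≤o∸n))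

module TwoBandStrategy {k : ℕ} (n : ℕ) {s w p q : ℕ} (s+w≡k : s + w ≡ k) (p+q≡N : p + q ≡ k ^ n) where

  high : ℕ
  high = suc (p * s + q * k)

  split : ℕ → ℕ → ℕ
  split i t with t <? s
  ... | yes _ = i * s + 1 + t
  ... | no  _ = i * w + high + (t ∸ s)

  middle : ℕ → ℕ → ℕ
  middle i t = i * k + suc (p * s) + t

  firing : (ℕ → ℕ) → Firing k
  firing g r = g (toℕ r)

  splits middles firings : List (Firing k)
  splits  = map (firing ∘ split) (range 0 p)
  middles = map (firing ∘ middle) (range 0 q)
  firings = splits ++ middles

  split-low : ∀ i {t} → t < s → split i t ≡ i * s + 1 + t
  split-low i {t} t<s with t <? s
  ... | yes _   = refl
  ... | no t≮s = contradiction t<s t≮s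

  split-high : ∀ i {t} → s ≤ t → split i t ≡ i * w + high + (t ∸ s)
  split-high i {t} s≤t with t <? s
  ... | yes t<s = contradiction s≤t (<⇒≱ t<s)
  ... | no _    = refl

  split-increasing : ∀ {i} → i < p → ∀ {t u} → t < u → split i t < split i u
  split-increasing {i} i<p {t} {u} t<u with t <? s | u <? s
  ... | yes _   | yes _   = +-monoʳ-< (i * s + 1) t<u
  ... | yes t<s | no _    = begin-strict
    i * s + 1 + t              ≡⟨ +-assoc (i * s) 1 t ⟩
    i * s + suc t              ≤⟨ +-monoʳ-≤ (i * s) t<s ⟩
    i * s + s                  ≡⟨ +-comm (i * s) s ⟩
    suc i * s                  ≤⟨ *-monoˡ-≤ s i<p ⟩
    p * s                      <⟨ s≤s (m≤m+n (p * s) (q * k)) ⟩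
    high                       ≤⟨ m≤n+m high (i * w) ⟩
    i * w + high               ≤⟨ m≤m+n (i * w + high) (u ∸ s) ⟩
    i * w + high + (u ∸ s)     ∎
    where open ≤-Reasoning
  ... | no t≮s  | yes u<s = contradiction (<-trans t<u u<s) t≮s
  ... | no t≮s  | no _    = +-monoʳ-< (i * w + high) (∸-monoˡ-< t<u (≮⇒≥ t≮s))

  toList-split : ∀ i → toList (firing (split i)) ≡ range (i * s + 1) s ++ range (i * w + high) w
  toList-split i = begin
    toList (firing (split i))                              ≡⟨ tabulate-toℕ (split i) ⟩
    map (split i) (range 0 k)                              ≡⟨ cong (map (split i) ∘ range 0) (sym s+w≡k) ⟩
    map (split i) (range 0 (s + w))                        ≡⟨ cong (map (split i)) (range-++ 0 s w) ⟩
    map (split i) (range 0 s ++ range s w)                 ≡⟨ map-++ (split i) (range 0 s) (range s w) ⟩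
    map (split i) (range 0 s) ++ map (split i) (range s w) ≡⟨ cong₂ _++_ (map-range (split i) 0 _ s (split-low i))
                                                                          (map-range (split i) s _ w split-high-shifted) ⟩
    range (i * s + 1) s ++ range (i * w + high) w          ∎
    where
    open ≡-Reasoning
    split-high-shifted : ∀ {t} → t < w → split i (s + t) ≡ i * w + high + t
    split-high-shifted {t} _ = trans (split-high i (m≤m+n s t)) (cong (i * w + high +_) (m+n∸m≡n s t))

  toList-middle : ∀ i → toList (firing (middle i)) ≡ range (i * k + suc (p * s)) k
  toList-middle i = trans (tabulate-toℕ (middle i)) (map-range (middle i) 0 _ k (λ _ → refl))

  concatMap-splits : concatMap toList splits ↭ range 1 (p * s) ++ range high (p * w)
  concatMap-splits = begin
    concatMap toList splits
      ≡⟨ concatMap-map toList (firing ∘ split) (range 0 p) ⟩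
    concatMap (toList ∘ firing ∘ split) (range 0 p)
      ≡⟨ concatMap-cong toList-split (range 0 p) ⟩
    concatMap (λ i → range (i * s + 1) s ++ range (i * w + high) w) (range 0 p)
      ↭⟨ concatMap-++-↭ (λ i → range (i * s + 1) s) (λ i → range (i * w + high) w) (range 0 p) ⟩
    concatMap (λ i → range (i * s + 1) s) (range 0 p) ++ concatMap (λ i → range (i * w + high) w) (range 0 p)
      ≡⟨ cong₂ _++_ (concatMap-range-blocks 1 s 0 p) (concatMap-range-blocks high w 0 p) ⟩
    range 1 (p * s) ++ range high (p * w) ∎
    where open PermutationReasoning

  concatMap-middles : concatMap toList middles ≡ range (suc (p * s)) (q * k)
  concatMap-middles = begin
    concatMap toList middles                                   ≡⟨ concatMap-map toList (firing ∘ middle) (range 0 q) ⟩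
    concatMap (toList ∘ firing ∘ middle) (range 0 q)           ≡⟨ concatMap-cong toList-middle (range 0 q) ⟩
    concatMap (λ i → range (i * k + suc (p * s)) k) (range 0 q) ≡⟨ concatMap-range-blocks (suc (p * s)) k 0 q ⟩
    range (suc (p * s)) (q * k)                                ∎
    where open ≡-Reasoning

  number-of-chips : p * s + (q * k + p * w) ≡ k ^ suc n
  number-of-chips = begin
    p * s + (q * k + p * w)       ≡⟨ cong (λ k → p * s + (q * k + p * w)) (sym s+w≡k) ⟩
    p * s + (q * (s + w) + p * w) ≡⟨ distribute p q s w ⟩
    (s + w) * (p + q)             ≡⟨ cong₂ _*_ s+w≡k p+q≡N ⟩
    k ^ suc n                     ∎
    where
    open ≡-Reasoning
    distribute : ∀ p q s w → p * s + (q * (s + w) + p * w) ≡ (s + w) * (p + q)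
    distribute = solve-∀

  usesAll : concatMap toList firings ↭ chips k (suc n)
  usesAll = begin
    concatMap toList (splits ++ middles)                ≡⟨ concatMap-++ toList splits middles ⟩
    concatMap toList splits ++ concatMap toList middles ↭⟨ ++⁺ʳ _ concatMap-splits ⟩
    (low ++ top) ++ concatMap toList middles            ≡⟨ cong ((low ++ top) ++_) concatMap-middles ⟩
    (low ++ top) ++ mid                                 ≡⟨ ++-assoc low top mid ⟩
    low ++ top ++ mid                                   ↭⟨ ++⁺ˡ low (↭-++-comm top mid) ⟩
    low ++ mid ++ top                                   ≡⟨ cong (low ++_) (range-++ (suc (p * s)) (q * k) (p * w)) ⟨
    low ++ range (suc (p * s)) (q * k + p * w)          ≡⟨ range-++ 1 (p * s) (q * k + p * w) ⟨
    range 1 (p * s + (q * k + p * w))                   ≡⟨ cong (range 1) number-of-chips ⟩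
    range 1 (k ^ suc n)                                 ≡⟨ chips≡range k (suc n) ⟨
    chips k (suc n)                                     ∎
    where
    open PermutationReasoning
    low mid top : List ℕ
    low = range 1 (p * s)
    mid = range (suc (p * s)) (q * k)
    top = range high (p * w)

  strategy : RootStrategy k (suc n)
  strategy = record
    { firings    = firings
    ; increasing = All.++⁺ (All.map⁺ (All-range 0 p (λ _ i<p _ _ → split-increasing i<p)))
                           (All.map⁺ (All.universal (λ i _ _ → +-monoʳ-< (i * k + suc (p * s))) (range 0 q)))
    ; usesAll    = usesAll
    }

  arrivals-strategy : ∀ j → arrivals strategy j ≡
    map (λ i → split i (toℕ j)) (range 0 p) ++ map (λ i → middle i (toℕ j)) (range 0 q)
  arrivals-strategy j = trans (map-++ (λ f → f j) splits middles)
                              (cong₂ _++_ (sym (map-∘ (range 0 p))) (sym (map-∘ (range 0 q))))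

  count-arrivals : ∀ {P : ℕ → Set} (P? : Decidable P) j → count P? (arrivals strategy j) ≡
    count P? (map (λ i → split i (toℕ j)) (range 0 p)) + count P? (map (λ i → middle i (toℕ j)) (range 0 q))
  count-arrivals P? j = trans (cong (count P?) (arrivals-strategy j))
    (count-++ P? (map (λ i → split i (toℕ j)) (range 0 p)) (map (λ i → middle i (toℕ j)) (range 0 q)))

  split-∈-arrivals : ∀ j {i} → i < p → split i (toℕ j) ∈ arrivals strategy j
  split-∈-arrivals j {i} i<p = subst (split i (toℕ j) ∈_) (sym (arrivals-strategy j))
    (∈-++⁺ˡ (∈-map⁺ (λ i → split i (toℕ j)) (∈-range⁺ z≤n i<p)))

  1+K∸w*p≡high : suc (k ^ suc n) ∸ w * p ≡ high
  1+K∸w*p≡high = begin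
    suc (k ^ suc n) ∸ w * p               ≡⟨ cong (λ K → suc K ∸ w * p) number-of-chips ⟨
    suc (p * s + (q * k + p * w)) ∸ w * p ≡⟨ cong (_∸ w * p) (regroup p q s w k) ⟩
    high + w * p ∸ w * p                  ≡⟨ m+n∸n≡m high (w * p) ⟩
    high                                  ∎
    where
    open ≡-Reasoning
    regroup : ∀ p q s w k → suc (p * s + (q * k + p * w)) ≡ suc (p * s + q * k) + w * p
    regroup = solve-∀

lowest-landing : ∀ {k n x} (j : Fin k) → suc x ≤ k ^ n → CanLand k (suc n) j (suc x) (suc (toℕ j) * suc x)
lowest-landing {k} {n} {x} j x<N = strategy , c∈arrivals , cong suc count-<≡x
  where
  open TwoBandStrategy n {s = suc (toℕ j)} {p = suc x} (m+[n∸m]≡n (toℕ<n j)) (m+[n∸m]≡n x<N)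
  c : ℕ
  c = suc (toℕ j) * suc x

  split-arrival middle-arrival : ℕ → ℕ
  split-arrival i  = split i (toℕ j)
  middle-arrival i = middle i (toℕ j)

  split-arrival≡ : ∀ i → split-arrival i ≡ suc (toℕ j) * suc i
  split-arrival≡ i = trans (split-low i ≤-refl) (rearrange i (toℕ j))
    where
    rearrange : ∀ i j → i * suc j + 1 + j ≡ suc j * suc i
    rearrange = solve-∀

  c∈arrivals : c ∈ arrivals strategy j
  c∈arrivals = subst (_∈ arrivals strategy j) (split-arrival≡ x) (split-∈-arrivals j ≤-refl)

  split-arrival<c : ∀ {i} → i < x → split-arrival i < c
  split-arrival<c {i} i<x = subst (_< c) (sym (split-arrival≡ i)) (*-monoʳ-< (suc (toℕ j)) (s≤s i<x))

  c≮middle-arrival : ∀ i → ¬ middle-arrival i < c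
  c≮middle-arrival i = ≤⇒≯ (begin
    suc (toℕ j) * suc x               ≡⟨ *-comm (suc (toℕ j)) (suc x) ⟩
    suc x * suc (toℕ j)               ≤⟨ n≤1+n _ ⟩
    suc (suc x * suc (toℕ j))         ≤⟨ m≤n+m _ (i * k) ⟩
    i * k + suc (suc x * suc (toℕ j)) ≤⟨ m≤m+n _ (toℕ j) ⟩
    middle-arrival i                  ∎)
    where open ≤-Reasoning

  count-split-arrivals : count (_<? c) (map split-arrival (range 0 (suc x))) ≡ x
  count-split-arrivals = begin
    count (_<? c) (map split-arrival (range 0 (suc x)))
      ≡⟨ cong (count (_<? c) ∘ map split-arrival) (range-suc 0 x) ⟩
    count (_<? c) (map split-arrival (range 0 x ++ [ x ]))
      ≡⟨ cong (count (_<? c)) (map-++ split-arrival (range 0 x) [ x ]) ⟩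
    count (_<? c) (map split-arrival (range 0 x) ++ [ split-arrival x ])
      ≡⟨ count-++ (_<? c) (map split-arrival (range 0 x)) [ split-arrival x ] ⟩
    count (_<? c) (map split-arrival (range 0 x)) + count (_<? c) [ split-arrival x ]
      ≡⟨ cong₂ _+_ (count-map-range-all (_<? c) split-arrival x split-arrival<c)
                   (count-reject (_<? c) (λ lt → n≮n c (subst (_< c) (split-arrival≡ x) lt))) ⟩
    x + 0
      ≡⟨ +-identityʳ x ⟩
    x ∎
    where open ≡-Reasoning

  count-<≡x : count (_<? c) (arrivals strategy j) ≡ x
  count-<≡x = begin
    count (_<? c) (arrivals strategy j)
      ≡⟨ count-arrivals (_<? c) j ⟩
    count (_<? c) (map split-arrival (range 0 (suc x))) + count (_<? c) (map middle-arrival (range 0 (k ^ n ∸ suc x)))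
      ≡⟨ cong₂ _+_ count-split-arrivals
                   (count-map-range-none (_<? c) middle-arrival (k ^ n ∸ suc x) (λ {i} _ → c≮middle-arrival i)) ⟩
    x + 0
      ≡⟨ +-identityʳ x ⟩
    x ∎
    where open ≡-Reasoning

highest-landing : ∀ {k n x} (j : Fin k) → suc x ≤ k ^ n →
                  CanLand k (suc n) j (suc x) (suc (k ^ suc n) ∸ (k ∸ toℕ j) * (k ^ n ∸ x))
highest-landing {k} {n} {x} j x<N =
  subst (CanLand k (suc n) j (suc x)) (sym 1+K∸w*p≡high) (strategy , high∈arrivals , cong suc count-<≡x)
  where
  p : ℕ
  p = k ^ n ∸ x
  open TwoBandStrategy n {s = toℕ j} {p = p} {q = x} (m+[n∸m]≡n (<⇒≤ (toℕ<n j))) (m∸n+n≡m (<⇒≤ x<N))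

  split-arrival middle-arrival : ℕ → ℕ
  split-arrival i  = split i (toℕ j)
  middle-arrival i = middle i (toℕ j)

  split-arrival≡ : ∀ i → split-arrival i ≡ i * (k ∸ toℕ j) + high
  split-arrival≡ i = trans (split-high i ≤-refl)
    (trans (cong (i * (k ∸ toℕ j) + high +_) (n∸n≡0 (toℕ j))) (+-identityʳ _))

  high∈arrivals : high ∈ arrivals strategy j
  high∈arrivals = subst (_∈ arrivals strategy j) (split-arrival≡ 0) (split-∈-arrivals j (m<n⇒0<n∸m x<N))

  high≮split-arrival : ∀ {i} → i < p → ¬ split-arrival i < high
  high≮split-arrival {i} _ = ≤⇒≯ (subst (high ≤_) (sym (split-arrival≡ i)) (m≤n+m high _))

  middle-arrival<high : ∀ {i} → i < x → middle-arrival i < high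
  middle-arrival<high {i} i<x = begin-strict
    i * k + suc (p * toℕ j) + toℕ j   ≡⟨ regroup (i * k) (p * toℕ j) (toℕ j) ⟩
    suc (p * toℕ j + (i * k + toℕ j)) <⟨ s≤s (+-monoʳ-< (p * toℕ j) ik+j<xk) ⟩
    high                              ∎
    where
    open ≤-Reasoning
    regroup : ∀ a b c → a + suc b + c ≡ suc (b + (a + c))
    regroup = solve-∀
    ik+j<xk : i * k + toℕ j < x * k
    ik+j<xk = begin-strict
      i * k + toℕ j <⟨ +-monoʳ-< (i * k) (toℕ<n j) ⟩
      i * k + k     ≡⟨ +-comm (i * k) k ⟩
      suc i * k     ≤⟨ *-monoˡ-≤ k i<x ⟩
      x * k         ∎

  count-<≡x : count (_<? high) (arrivals strategy j) ≡ x
  count-<≡x = trans (count-arrivals (_<? high) j)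
    (cong₂ _+_ (count-map-range-none (_<? high) split-arrival p high≮split-arrival)
               (count-map-range-all (_<? high) middle-arrival x middle-arrival<high))

proposition4p6 : (k n : ℕ) → 2 ≤ k → 1 ≤ n →
    (j : Fin k) → (x : ℕ) → 1 ≤ x → x ≤ k ^ (n ∸ 1) →
    IsLeast (CanLand k n j x) (suc (toℕ j) * x)
    × IsGreatest (CanLand k n j x)
        (k ^ n + 1 ∸ (k ^ (n ∸ 1) + 1 ∸ x) * (k + 1 ∸ suc (toℕ j)))
-- The hypothesis 2 ≤ k is not needed: an index j : Fin k already makes k nonzero.
proposition4p6 k (suc n) _ _ j (suc x) _ x<N =
    (lowest-landing j x<N , λ _ → landing-lowerBound)
  , ( subst (CanLand k (suc n) j (suc x)) (sym b≡) (highest-landing j x<N)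
    , λ c land → subst (c ≤_) (sym b≡) (m+n≤o⇒m≤o∸n c (landing-upperBound land)) )
  where
  b≡ : k ^ suc n + 1 ∸ (k ^ n + 1 ∸ suc x) * (k + 1 ∸ suc (toℕ j))
     ≡ suc (k ^ suc n) ∸ (k ∸ toℕ j) * (k ^ n ∸ x)
  b≡ = cong₂ _∸_ (+-comm (k ^ suc n) 1)
    (trans (cong₂ _*_ (cong (_∸ suc x) (+-comm (k ^ n) 1)) (cong (_∸ suc (toℕ j)) (+-comm k 1)))
           (*-comm (k ^ n ∸ x) (k ∸ toℕ j)))
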